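{- Let $\mathbf{F}_q$ be a finite field with $q\equiv 1\pmod 4$, let $d=(q-1)/4$, and let $g$ be a generator of the multiplicative group $\mathbf{F}_q^*$. For an integer $i$ with $0\le i\le d-1$ define \[a_0=\frac{(g^2+1)(g^{2(4i+2)}+1)}{4g^{4i+3}},\qquad a_1=\frac{(g^{d+2}+1)(g^{2(4i+2)}-1)}{4g^{4i+d+3}},\] \[a_2=\frac{(g^2-1)(g^{2(4i+2)}+1)}{4g^{4i+3}},\qquad a_3=\frac{(g^{d+2}-1)(g^{2(4i+2)}-1)}{4g^{4i+d+3}}.\] Then the polynomial $f(x)=a_3x^{3d+1}+a_2x^{2d+1}+a_1x^{d+1}+a_0x\in\mathbf{F}_q[x]$ induces an involution of $\mathbf{F}_q$ (i.e. $f(f(x))=x$ for all $x\in\mathbf{F}_q$), and $0$ is the only element $x\in\mathbf{F}_q$ with $f(x)=x$.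
   Context: A polynomial $f\in\mathbf{F}_q[x]$ is regarded as the function $x\mapsto f(x)$ on $\mathbf{F}_q$. An involution of $\mathbf{F}_q$ is a map $f:\mathbf{F}_q\to\mathbf{F}_q$ with $f\circ f=\mathrm{id}$. A fixed point of $f$ is an $x\in\mathbf{F}_q$ with $f(x)=x$. -}

module Defs where

open import Level using (Level; _⊔_) renaming (suc to lsuc)
open import Data.Nat using (ℕ; _∸_)
import Data.Nat as N
import Data.Nat.DivMod as Nat
open import Data.Fin using (Fin)
open import Data.Product using (∃)
open import Relation.Nullary using (¬_)
open import Algebra.Bundles using (CommutativeRing; Semiring)
open import Function.Bundles using (Inverse)
import Relation.Binary.PropositionalEquality as ≡

-- A finite field: a commutative ring (with setoid equality _≈_) in which
-- 0 ≠ 1, every nonzero element has a multiplicative inverse (given by a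
-- total operation _⁻¹, as in Mathlib's `Field`; its value at 0 is
-- irrelevant), and whose carrier (up to _≈_) is in bijection with Fin size.
record FiniteField (c ℓ : Level) : Set (lsuc (c ⊔ ℓ)) where
  field
    commRing : CommutativeRing c ℓ
  open CommutativeRing commRing public
  field
    _⁻¹      : Carrier → Carrier
    0≉1      : ¬ (0# ≈ 1#)
    inverseʳ : ∀ x → ¬ (x ≈ 0#) → (x * (x ⁻¹)) ≈ 1#
    size     : ℕ
    finite   : Inverse setoid (≡.setoid (Fin size))

  open import Algebra.Definitions.RawSemiring (Semiring.rawSemiring semiring) public using (_^_)

  _/_ : Carrier → Carrier → Carrier
  a / b = a * (b ⁻¹)

  IsGenerator : Carrier → Set (c ⊔ ℓ)
  IsGenerator g = ¬ (g ≈ 0#) × (∀ x → ¬ (x ≈ 0#) → ∃ λ (k : ℕ) → (g ^ k) ≈ x)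
    where open import Data.Product using (_×_)

  d : ℕ
  d = (size ∸ 1) Nat./ 4

  four : Carrier
  four = 1# + 1# + 1# + 1#

  a₀ a₁ a₂ a₃ : Carrier → ℕ → Carrier
  a₀ g i = ((g ^ 2 + 1#) * (g ^ (2 N.* (4 N.* i N.+ 2)) + 1#)) / (four * g ^ (4 N.* i N.+ 3))
  a₁ g i = ((g ^ (d N.+ 2) + 1#) * (g ^ (2 N.* (4 N.* i N.+ 2)) - 1#)) / (four * g ^ (4 N.* i N.+ d N.+ 3))
  a₂ g i = ((g ^ 2 - 1#) * (g ^ (2 N.* (4 N.* i N.+ 2)) + 1#)) / (four * g ^ (4 N.* i N.+ 3))
  a₃ g i = ((g ^ (d N.+ 2) - 1#) * (g ^ (2 N.* (4 N.* i N.+ 2)) - 1#)) / (four * g ^ (4 N.* i N.+ d N.+ 3))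

  f : Carrier → ℕ → Carrier → Carrier
  f g i x = a₃ g i * x ^ (3 N.* d N.+ 1) + a₂ g i * x ^ (2 N.* d N.+ 1)
            + a₁ g i * x ^ (d N.+ 1) + a₀ g i * x

{-# OPTIONS --safe #-}
-- Write f x = x · h (x ^ d) with h y = a₃ y³ + a₂ y² + a₁ y + a₀. As g has order q - 1 = 4d,
-- ω = g ^ d satisfies ω² = -1 and x ^ d = ω ^ r on the coset x = g ^ (r + 4k) of the fourth
-- powers. A computation gives h (ω ^ r) = g ^ eᵣ with (e₀, e₁, e₂, e₃) = (4i+3, 4i+1, 4j+3, 4j+1),
-- where d = i + j + 1. So f multiplies the coset r by g ^ eᵣ, which moves it to the coset 3 - r;
-- as eᵣ + e₃₋ᵣ = 4d, f ∘ f is the identity, and as 0 < eᵣ < 4d, no nonzero x is fixed.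
module Submission where

open import Defs
open import Level using (Level)
open import Data.Nat as ℕ using (ℕ; _<_; _%_)
open import Relation.Nullary using (¬_)
open import Relation.Binary.PropositionalEquality using (_≡_)
open import Data.Product using (_×_; _,_)
open import Algebra.Bundles using (CommutativeRing)

-- Integer coefficients let the ring solver cancel constants (1 - 1 = 0) in any commutative ring.
module IntegerCoefficientSolver {c ℓ : Level} (R : CommutativeRing c ℓ) where
  open CommutativeRing R
  open import Data.Nat.Base as ℕ using (zero; suc)
  import Data.Nat.Properties as ℕ
  open import Data.Integer.Base as ℤ using (ℤ; +_; -[1+_]; _⊖_; sign; ∣_∣; _◃_; +-*-rawRing)
  import Data.Integer.Properties as ℤ
  open import Data.Sign.Base as Sign using (Sign)
  open import Data.Maybe.Base using (Maybe; just; nothing)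
  open import Relation.Nullary.Decidable using (yes; no)
  import Relation.Binary.PropositionalEquality as ≡
  open import Algebra.Solver.Ring.AlmostCommutativeRing
    using (fromCommutativeRing; _-Raw-AlmostCommutative⟶_)
  open import Algebra.Properties.Semiring.Mult.TCOptimised semiring using (×-homo-+; ×1-homo-*) renaming (_×_ to _×′_)
  open import Algebra.Properties.Ring ring using (-‿involutive; -0#≈0#; -1*x≈-x; -‿+-comm)
  open import Algebra.Properties.CommutativeSemigroup +-commutativeSemigroup
    using () renaming (interchange to +-interchange)
  open import Algebra.Properties.CommutativeSemigroup *-commutativeSemigroup
    using () renaming (interchange to *-interchange)
  open import Relation.Binary.Reasoning.Setoid setoid

  private
    ⟦_⟧ℤ : ℤ → Carrier
    ⟦ + n ⟧ℤ      = n ×′ 1#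
    ⟦ -[1+ n ] ⟧ℤ = - (suc n ×′ 1#)

    ⟦_⟧ₛ : Sign → Carrier
    ⟦ Sign.+ ⟧ₛ = 1#
    ⟦ Sign.- ⟧ₛ = - 1#

    -‿homo : ∀ i → ⟦ ℤ.- i ⟧ℤ ≈ - ⟦ i ⟧ℤ
    -‿homo (+ zero)  = sym -0#≈0#
    -‿homo (+ suc n) = refl
    -‿homo -[1+ n ]  = sym (-‿involutive _)

    [x+y]-[x+z]≈y-z : ∀ x y z → (x + y) - (x + z) ≈ y - z
    [x+y]-[x+z]≈y-z x y z = begin
      (x + y) - (x + z)     ≈⟨ +-congˡ (-‿+-comm x z) ⟨
      (x + y) + (- x - z)   ≈⟨ +-interchange x y (- x) (- z) ⟩
      (x - x) + (y - z)     ≈⟨ +-congʳ (-‿inverseʳ x) ⟩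
      0# + (y - z)          ≈⟨ +-identityˡ _ ⟩
      y - z                 ∎

    ⊖-homo : ∀ m n → ⟦ m ⊖ n ⟧ℤ ≈ m ×′ 1# - n ×′ 1#
    ⊖-homo m       zero    = sym (trans (+-congˡ -0#≈0#) (+-identityʳ _))
    ⊖-homo zero    (suc n) = sym (+-identityˡ _)
    ⊖-homo (suc m) (suc n) = begin
      ⟦ suc m ⊖ suc n ⟧ℤ               ≡⟨ ≡.cong ⟦_⟧ℤ (ℤ.[1+m]⊖[1+n]≡m⊖n m n) ⟩
      ⟦ m ⊖ n ⟧ℤ                       ≈⟨ ⊖-homo m n ⟩
      m ×′ 1# - n ×′ 1#                ≈⟨ [x+y]-[x+z]≈y-z 1# _ _ ⟨
      (1# + m ×′ 1#) - (1# + n ×′ 1#)  ≈⟨ +-congˡ (-‿cong (×-homo-+ 1# 1 n)) ⟨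
      (1# + m ×′ 1#) - suc n ×′ 1#     ≈⟨ +-congʳ (×-homo-+ 1# 1 m) ⟨
      suc m ×′ 1# - suc n ×′ 1#        ∎

    +-homo : ∀ i j → ⟦ i ℤ.+ j ⟧ℤ ≈ ⟦ i ⟧ℤ + ⟦ j ⟧ℤ
    +-homo (+ m)    (+ n)    = ×-homo-+ 1# m n
    +-homo (+ m)    -[1+ n ] = ⊖-homo m (suc n)
    +-homo -[1+ m ] (+ n)    = trans (⊖-homo n (suc m)) (+-comm _ _)
    +-homo -[1+ m ] -[1+ n ] = begin
      - (suc (suc (m ℕ.+ n)) ×′ 1#)       ≡⟨ ≡.cong (λ k → - (suc k ×′ 1#)) (ℕ.+-suc m n) ⟨
      - ((suc m ℕ.+ suc n) ×′ 1#)         ≈⟨ -‿cong (×-homo-+ 1# (suc m) (suc n)) ⟩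
      - (suc m ×′ 1# + suc n ×′ 1#)         ≈⟨ -‿+-comm _ _ ⟨
      - (suc m ×′ 1#) + - (suc n ×′ 1#)     ∎

    ◃-homo : ∀ s n → ⟦ s ◃ n ⟧ℤ ≈ ⟦ s ⟧ₛ * n ×′ 1#
    ◃-homo s      zero    = sym (zeroʳ ⟦ s ⟧ₛ)
    ◃-homo Sign.+ (suc n) = sym (*-identityˡ _)
    ◃-homo Sign.- (suc n) = sym (-1*x≈-x _)

    sign-homo : ∀ s t → ⟦ s Sign.* t ⟧ₛ ≈ ⟦ s ⟧ₛ * ⟦ t ⟧ₛ
    sign-homo Sign.+ t      = sym (*-identityˡ _)
    sign-homo Sign.- Sign.+ = sym (*-identityʳ _)
    sign-homo Sign.- Sign.- = sym (trans (-1*x≈-x _) (-‿involutive _))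

    *-homo : ∀ i j → ⟦ i ℤ.* j ⟧ℤ ≈ ⟦ i ⟧ℤ * ⟦ j ⟧ℤ
    *-homo i j = begin
      ⟦ sign i Sign.* sign j ◃ ∣ i ∣ ℕ.* ∣ j ∣ ⟧ℤ
        ≈⟨ ◃-homo (sign i Sign.* sign j) (∣ i ∣ ℕ.* ∣ j ∣) ⟩
      ⟦ sign i Sign.* sign j ⟧ₛ * (∣ i ∣ ℕ.* ∣ j ∣) ×′ 1#
        ≈⟨ *-cong (sign-homo (sign i) (sign j)) (×1-homo-* ∣ i ∣ ∣ j ∣) ⟩
      (⟦ sign i ⟧ₛ * ⟦ sign j ⟧ₛ) * (∣ i ∣ ×′ 1# * ∣ j ∣ ×′ 1#)
        ≈⟨ *-interchange _ _ _ _ ⟩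
      (⟦ sign i ⟧ₛ * ∣ i ∣ ×′ 1#) * (⟦ sign j ⟧ₛ * ∣ j ∣ ×′ 1#)
        ≈⟨ *-cong (◃-homo (sign i) ∣ i ∣) (◃-homo (sign j) ∣ j ∣) ⟨
      ⟦ sign i ◃ ∣ i ∣ ⟧ℤ * ⟦ sign j ◃ ∣ j ∣ ⟧ℤ
        ≡⟨ ≡.cong₂ (λ a b → ⟦ a ⟧ℤ * ⟦ b ⟧ℤ) (ℤ.◃-inverse i) (ℤ.◃-inverse j) ⟩
      ⟦ i ⟧ℤ * ⟦ j ⟧ℤ ∎

    ℤ-homomorphism : +-*-rawRing -Raw-AlmostCommutative⟶ fromCommutativeRing R
    ℤ-homomorphism = record
      { ⟦_⟧ = ⟦_⟧ℤ ; +-homo = +-homo ; *-homo = *-homo ; -‿homo = -‿homo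
      ; 0-homo = refl ; 1-homo = refl }

    ℤ-coeff≟ : ∀ i j → Maybe (⟦ i ⟧ℤ ≈ ⟦ j ⟧ℤ)
    ℤ-coeff≟ i j with i ℤ.≟ j
    ... | yes ≡.refl = just refl
    ... | no _       = nothing

  open import Algebra.Solver.Ring +-*-rawRing (fromCommutativeRing R) ℤ-homomorphism ℤ-coeff≟ public

module CommutativeRingProperties {c ℓ : Level} (R : CommutativeRing c ℓ) where
  open CommutativeRing R
  open IntegerCoefficientSolver R using (solve; _:=_; _:+_; _:*_; _:-_; :-_; con)
  open import Data.Integer.Base using (+_)
  open import Data.Nat.Base as ℕ using (zero; suc)
  import Data.Nat.Properties as ℕ
  open import Algebra.Properties.Semiring.Exp semiring using (_^_; ^-congˡ; ^-congʳ; ^-homo-*; ^-assocʳ)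
  open import Relation.Binary.Reasoning.Setoid setoid

  inverse-unique : ∀ {x y z} → x * y ≈ 1# → x * z ≈ 1# → y ≈ z
  inverse-unique {x} {y} {z} xy≈1 xz≈1 = begin
    y            ≈⟨ *-identityʳ y ⟨
    y * 1#       ≈⟨ *-congˡ xz≈1 ⟨
    y * (x * z)  ≈⟨ *-assoc y x z ⟨
    (y * x) * z  ≈⟨ *-congʳ (trans (*-comm y x) xy≈1) ⟩
    1# * z       ≈⟨ *-identityˡ z ⟩
    z            ∎

  1+1≈0⇒-1≈1 : 1# + 1# ≈ 0# → - 1# ≈ 1#
  1+1≈0⇒-1≈1 2≈0 = begin
    - 1#               ≈⟨ +-identityˡ (- 1#) ⟨
    0# + - 1#          ≈⟨ +-congʳ 2≈0 ⟨
    (1# + 1#) + - 1#   ≈⟨ solve 0 ((con (+ 1) :+ con (+ 1)) :- con (+ 1) := con (+ 1)) refl ⟩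
    1#                 ∎

  1+1+1+1≈[1+1]*[1+1] : 1# + 1# + 1# + 1# ≈ (1# + 1#) * (1# + 1#)
  1+1+1+1≈[1+1]*[1+1] = solve 0 (con (+ 4) := (con (+ 2)) :* con (+ 2)) refl

  [x-1]*[x+1]≈x*x-1 : ∀ x → (x - 1#) * (x + 1#) ≈ x * x - 1#
  [x-1]*[x+1]≈x*x-1 = solve 1 (λ x → (x :- con (+ 1)) :* (x :+ con (+ 1)) := x :* x :- con (+ 1)) refl

  1#^n≈1# : ∀ n → 1# ^ n ≈ 1#
  1#^n≈1# zero    = refl
  1#^n≈1# (suc n) = trans (*-identityˡ _) (1#^n≈1# n)

  ^-periodic : ∀ {x n} → x ^ n ≈ 1# → ∀ r q → x ^ (r ℕ.+ q ℕ.* n) ≈ x ^ r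
  ^-periodic {x} {n} xⁿ≈1 r q = begin
    x ^ (r ℕ.+ q ℕ.* n)       ≈⟨ ^-homo-* x r (q ℕ.* n) ⟩
    x ^ r * x ^ (q ℕ.* n)     ≈⟨ *-congˡ (^-congʳ x (ℕ.*-comm q n)) ⟩
    x ^ r * x ^ (n ℕ.* q)     ≈⟨ *-congˡ (^-assocʳ x n q) ⟨
    x ^ r * (x ^ n) ^ q       ≈⟨ *-congˡ (trans (^-congˡ q xⁿ≈1) (1#^n≈1# q)) ⟩
    x ^ r * 1#                ≈⟨ *-identityʳ _ ⟩
    x ^ r                     ∎

  ^-+1 : ∀ x m → x ^ (m ℕ.+ 1) ≈ x ^ m * x
  ^-+1 x m = trans (^-homo-* x m 1) (*-congˡ (*-identityʳ x))

  ^-*-+1 : ∀ x k m → x ^ (k ℕ.* m ℕ.+ 1) ≈ (x ^ m) ^ k * x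
  ^-*-+1 x k m = trans (^-+1 x (k ℕ.* m))
    (*-congʳ (trans (^-congʳ x (ℕ.*-comm k m)) (sym (^-assocʳ x m k))))

  cubic : (a₀ a₁ a₂ a₃ y : Carrier) → Carrier
  cubic a₀ a₁ a₂ a₃ y = a₃ * (y * y * y) + a₂ * (y * y) + a₁ * y + a₀

  cubic-congʳ : ∀ {a₀ a₁ a₂ a₃ y z} → y ≈ z → cubic a₀ a₁ a₂ a₃ y ≈ cubic a₀ a₁ a₂ a₃ z
  cubic-congʳ y≈z = +-congʳ (+-cong (+-cong (*-congˡ (*-cong (*-cong y≈z y≈z) y≈z))
    (*-congˡ (*-cong y≈z y≈z))) (*-congˡ y≈z))

  cubic-at-square-root : ∀ {a₀ a₁ a₂ a₃ y ε} → y * y ≈ ε →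
                         cubic a₀ a₁ a₂ a₃ y ≈ (a₀ + a₂ * ε) + y * (a₁ + a₃ * ε)
  cubic-at-square-root {a₀} {a₁} {a₂} {a₃} {y} {ε} y*y≈ε = begin
    cubic a₀ a₁ a₂ a₃ y                                ≈⟨ even-odd a₀ a₁ a₂ a₃ y ⟩
    (a₀ + a₂ * (y * y)) + y * (a₁ + a₃ * (y * y))      ≈⟨ +-cong (+-congˡ (*-congˡ y*y≈ε))
                                                             (*-congˡ (+-congˡ (*-congˡ y*y≈ε))) ⟩
    (a₀ + a₂ * ε) + y * (a₁ + a₃ * ε)                  ∎
    where
    even-odd : ∀ a₀ a₁ a₂ a₃ y →
               cubic a₀ a₁ a₂ a₃ y ≈ (a₀ + a₂ * (y * y)) + y * (a₁ + a₃ * (y * y))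
    even-odd = solve 5 (λ a₀ a₁ a₂ a₃ y →
      a₃ :* (y :* y :* y) :+ a₂ :* (y :* y) :+ a₁ :* y :+ a₀
        := (a₀ :+ a₂ :* (y :* y)) :+ y :* (a₁ :+ a₃ :* (y :* y))) refl

-- With u = g², s = g ^ (4i+1), ω = g ^ d and w = (4 g ^ (4i+3))⁻¹ the cₖ are the aₖ of f;
-- for a₁ and a₃ this uses (4 g ^ (4i+d+3))⁻¹ = -(ω w), which holds as ω² = -1.
module Multiplier {c ℓ : Level} (R : CommutativeRing c ℓ) where
  open CommutativeRing R
  open CommutativeRingProperties R using (cubic; cubic-at-square-root)
  open IntegerCoefficientSolver R using (solve; _:=_; _:+_; _:*_; _:-_; :-_; con; Polynomial)
  open import Data.Integer.Base using (+_)
  open import Relation.Binary.Reasoning.Setoid setoid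

  c₀ c₁ c₂ c₃ : (u s ω w : Carrier) → Carrier
  c₀ u s ω w = (u + 1#) * (u * (s * s) + 1#) * w
  c₁ u s ω w = (ω * u + 1#) * (u * (s * s) - 1#) * (- (ω * w))
  c₂ u s ω w = (u - 1#) * (u * (s * s) + 1#) * w
  c₃ u s ω w = (ω * u - 1#) * (u * (s * s) - 1#) * (- (ω * w))

  multiplier : (u s ω w y : Carrier) → Carrier
  multiplier u s ω w = cubic (c₀ u s ω w) (c₁ u s ω w) (c₂ u s ω w) (c₃ u s ω w)

  private
    D κ : (u s w : Carrier) → Carrier
    D u s w = (1# + 1# + 1# + 1#) * (u * s) * w
    κ u s w = (1# + 1#) * (u * (s * s) - 1#) * w

    one : ∀ {n} → Polynomial n
    one = con (+ 1)

    C₀ C₁ C₂ C₃ : ∀ {n} → (u s ω w : Polynomial n) → Polynomial n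
    C₀ u s ω w = (u :+ one) :* (u :* (s :* s) :+ one) :* w
    C₁ u s ω w = (ω :* u :+ one) :* (u :* (s :* s) :- one) :* (:- (ω :* w))
    C₂ u s ω w = (u :- one) :* (u :* (s :* s) :+ one) :* w
    C₃ u s ω w = (ω :* u :- one) :* (u :* (s :* s) :- one) :* (:- (ω :* w))

    D′ κ′ : ∀ {n} → (u s w : Polynomial n) → Polynomial n
    D′ u s w = con (+ 4) :* (u :* s) :* w
    κ′ u s w = con (+ 2) :* (u :* (s :* s) :- one) :* w

    even-part odd-part : (u s ω w ε : Carrier) → Carrier
    even-part u s ω w ε = c₀ u s ω w + c₂ u s ω w * ε
    odd-part  u s ω w ε = c₁ u s ω w + c₃ u s ω w * ε

    -- Each value is D (that is 1) times the claimed value, plus a multiple of ω² + 1 (that is 0).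
    value-at-1 : ∀ u s ω w → even-part u s ω w 1# + 1# * odd-part u s ω w 1#
                             ≈ (u * s) * D u s w + (ω * ω + 1#) * (- (u * κ u s w))
    value-at-1 = solve 4 (λ u s ω w →
      (C₀ u s ω w :+ C₂ u s ω w :* one) :+ one :* (C₁ u s ω w :+ C₃ u s ω w :* one)
        := (u :* s) :* D′ u s w :+ (ω :* ω :+ one) :* (:- (u :* κ′ u s w))) refl

    value-at-ω : ∀ u s ω w → even-part u s ω w (- 1#) + ω * odd-part u s ω w (- 1#)
                             ≈ s * D u s w + (ω * ω + 1#) * (- κ u s w)
    value-at-ω = solve 4 (λ u s ω w →
      (C₀ u s ω w :+ C₂ u s ω w :* (:- one)) :+ ω :* (C₁ u s ω w :+ C₃ u s ω w :* (:- one))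
        := s :* D′ u s w :+ (ω :* ω :+ one) :* (:- κ′ u s w)) refl

    value-at--1 : ∀ u s ω w → s * (even-part u s ω w 1# + - 1# * odd-part u s ω w 1#)
                              ≈ 1# * D u s w + (ω * ω + 1#) * (u * κ u s w * s)
    value-at--1 = solve 4 (λ u s ω w →
      s :* ((C₀ u s ω w :+ C₂ u s ω w :* one) :+ (:- one) :* (C₁ u s ω w :+ C₃ u s ω w :* one))
        := one :* D′ u s w :+ (ω :* ω :+ one) :* (u :* κ′ u s w :* s)) refl

    value-at--ω : ∀ u s ω w → (u * s) * (even-part u s ω w (- 1#) + - ω * odd-part u s ω w (- 1#))
                              ≈ 1# * D u s w + (ω * ω + 1#) * (κ u s w * (u * s))
    value-at--ω = solve 4 (λ u s ω w →
      (u :* s) :* ((C₀ u s ω w :+ C₂ u s ω w :* (:- one)) :+ (:- ω) :* (C₁ u s ω w :+ C₃ u s ω w :* (:- one)))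
        := one :* D′ u s w :+ (ω :* ω :+ one) :* (κ′ u s w :* (u :* s))) refl

    ω-shifted-inverse : ∀ u s ω w → (1# + 1# + 1# + 1#) * (u * s * ω) * (- (ω * w))
                                    ≈ 1# * D u s w + (ω * ω + 1#) * (- D u s w)
    ω-shifted-inverse = solve 4 (λ u s ω w →
      con (+ 4) :* (u :* s :* ω) :* (:- (ω :* w))
        := one :* D′ u s w :+ (ω :* ω :+ one) :* (:- D′ u s w)) refl

    -1*-1≈1 : - 1# * - 1# ≈ 1#
    -1*-1≈1 = solve 0 ((:- one) :* (:- one) := one) refl

    -x*-x≈x*x : ∀ x → - x * - x ≈ x * x
    -x*-x≈x*x = solve 1 (λ x → (:- x) :* (:- x) := x :* x) refl

  module _ {u s ω w : Carrier} (ω*ω≈-1 : ω * ω ≈ - 1#)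
           (D≈1 : (1# + 1# + 1# + 1#) * (u * s) * w ≈ 1#) where

    private
      reduce : ∀ x k → x * D u s w + (ω * ω + 1#) * k ≈ x
      reduce x k = begin
        x * D u s w + (ω * ω + 1#) * k   ≈⟨ +-cong (*-congˡ D≈1) (*-congʳ (+-congʳ ω*ω≈-1)) ⟩
        x * 1# + (- 1# + 1#) * k         ≈⟨ +-cong (*-identityʳ x) (*-congʳ (-‿inverseˡ 1#)) ⟩
        x + 0# * k                       ≈⟨ +-congˡ (zeroˡ k) ⟩
        x + 0#                           ≈⟨ +-identityʳ x ⟩
        x                                ∎

    multiplier-at-1 : multiplier u s ω w 1# ≈ u * s
    multiplier-at-1 = trans (cubic-at-square-root (*-identityˡ 1#))
                            (trans (value-at-1 u s ω w) (reduce _ _))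

    multiplier-at-ω : multiplier u s ω w ω ≈ s
    multiplier-at-ω = trans (cubic-at-square-root ω*ω≈-1)
                            (trans (value-at-ω u s ω w) (reduce _ _))

    multiplier-at--1 : s * multiplier u s ω w (- 1#) ≈ 1#
    multiplier-at--1 = trans (*-congˡ (cubic-at-square-root -1*-1≈1))
                             (trans (value-at--1 u s ω w) (reduce _ _))

    multiplier-at--ω : (u * s) * multiplier u s ω w (- ω) ≈ 1#
    multiplier-at--ω = trans (*-congˡ (cubic-at-square-root (trans (-x*-x≈x*x ω) ω*ω≈-1)))
                             (trans (value-at--ω u s ω w) (reduce _ _))

    ω-shifted-inverse≈1 : (1# + 1# + 1# + 1#) * (u * s * ω) * (- (ω * w)) ≈ 1#
    ω-shifted-inverse≈1 = trans (ω-shifted-inverse u s ω w) (reduce _ _)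

module FiniteFieldProperties {c ℓ : Level} (F : FiniteField c ℓ) where
  open FiniteField F
  open CommutativeRingProperties commRing
    using (inverse-unique; 1+1≈0⇒-1≈1; 1+1+1+1≈[1+1]*[1+1]; [x-1]*[x+1]≈x*x-1)
  open import Data.Nat.Base as ℕ using (zero; suc)
  open import Data.Nat.DivMod using (m≡m%n+[m/n]*n; m*n/n≡m) renaming (_/_ to _div_)
  import Data.Fin.Properties as Fin
  open import Relation.Nullary using (¬_; Dec)
  open import Relation.Nullary.Decidable using (map′)
  import Relation.Binary.PropositionalEquality as ≡
  open import Function.Bundles using (Inverse; Injection)
  open import Function.Properties.Inverse using (Inverse⇒Injection)
  open import Algebra.Properties.Ring ring using (x∙y⁻¹≈ε⇒x≈y; +-inverseˡ-unique)
  open import Relation.Binary.Reasoning.Setoid setoid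
  open Inverse finite using (to; from; to-cong; strictlyInverseˡ)

  size≡1+d*4 : size % 4 ≡ 1 → size ≡ suc (d ℕ.* 4)
  size≡1+d*4 size%4≡1 = ≡.trans size≡ (≡.cong (λ m → suc (m ℕ.* 4)) (≡.sym d≡size/4))
    where
    size≡ : size ≡ suc (size div 4 ℕ.* 4)
    size≡ = ≡.trans (m≡m%n+[m/n]*n size 4) (≡.cong (ℕ._+ size div 4 ℕ.* 4) size%4≡1)
    d≡size/4 : d ≡ size div 4
    d≡size/4 = ≡.trans (≡.cong (λ m → (m ℕ.∸ 1) div 4) size≡) (m*n/n≡m (size div 4) 4)

  to-injective : ∀ {x y} → to x ≡ to y → x ≈ y
  to-injective = Injection.injective (Inverse⇒Injection finite)

  from-injective : ∀ {a b} → from a ≈ from b → a ≡ b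
  from-injective {a} {b} eq =
    ≡.trans (≡.sym (strictlyInverseˡ a)) (≡.trans (to-cong eq) (strictlyInverseˡ b))

  _≈?_ : ∀ x y → Dec (x ≈ y)
  x ≈? y = map′ to-injective to-cong (to x Fin.≟ to y)

  *-cancelˡ : ∀ {x y z} → ¬ x ≈ 0# → x * y ≈ x * z → y ≈ z
  *-cancelˡ {x} {y} {z} x≉0 xy≈xz = begin
    y                 ≈⟨ *-identityˡ y ⟨
    1# * y            ≈⟨ *-congʳ x⁻¹x≈1 ⟨
    (x ⁻¹ * x) * y    ≈⟨ *-assoc _ x y ⟩
    x ⁻¹ * (x * y)    ≈⟨ *-congˡ xy≈xz ⟩
    x ⁻¹ * (x * z)    ≈⟨ *-assoc _ x z ⟨
    (x ⁻¹ * x) * z    ≈⟨ *-congʳ x⁻¹x≈1 ⟩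
    1# * z            ≈⟨ *-identityˡ z ⟩
    z                 ∎
    where
    x⁻¹x≈1 : x ⁻¹ * x ≈ 1#
    x⁻¹x≈1 = trans (*-comm _ x) (inverseʳ x x≉0)

  x*y≈0⇒y≈0 : ∀ {x y} → ¬ x ≈ 0# → x * y ≈ 0# → y ≈ 0#
  x*y≈0⇒y≈0 {x} x≉0 xy≈0 = *-cancelˡ x≉0 (trans xy≈0 (sym (zeroʳ x)))

  *-nonzero : ∀ {x y} → ¬ x ≈ 0# → ¬ y ≈ 0# → ¬ x * y ≈ 0#
  *-nonzero x≉0 y≉0 xy≈0 = y≉0 (x*y≈0⇒y≈0 x≉0 xy≈0)

  ^-nonzero : ∀ {x} → ¬ x ≈ 0# → ∀ k → ¬ x ^ k ≈ 0#
  ^-nonzero x≉0 zero    1≈0 = 0≉1 (sym 1≈0)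
  ^-nonzero x≉0 (suc k)     = *-nonzero x≉0 (^-nonzero x≉0 k)

  ⁻¹-unique : ∀ {x y} → x * y ≈ 1# → y ≈ x ⁻¹
  ⁻¹-unique {x} {y} xy≈1 = inverse-unique xy≈1 (inverseʳ x x≉0)
    where
    x≉0 : ¬ x ≈ 0#
    x≉0 x≈0 = 0≉1 (trans (sym (trans (*-congʳ x≈0) (zeroˡ y))) xy≈1)

  x*x≈1⇒x≈-1 : ∀ {x} → x * x ≈ 1# → ¬ x ≈ 1# → x ≈ - 1#
  x*x≈1⇒x≈-1 {x} x*x≈1 x≉1 = +-inverseˡ-unique x 1# (x*y≈0⇒y≈0 x-1≉0 (begin
    (x - 1#) * (x + 1#)   ≈⟨ [x-1]*[x+1]≈x*x-1 x ⟩
    x * x - 1#            ≈⟨ +-congʳ x*x≈1 ⟩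
    1# - 1#               ≈⟨ -‿inverseʳ 1# ⟩
    0#                    ∎))
    where
    x-1≉0 : ¬ x - 1# ≈ 0#
    x-1≉0 x-1≈0 = x≉1 (x∙y⁻¹≈ε⇒x≈y x 1# x-1≈0)

  four≉0 : ¬ - 1# ≈ 1# → ¬ four ≈ 0#
  four≉0 -1≉1 four≈0 = *-nonzero 2≉0 2≉0 (trans (sym 1+1+1+1≈[1+1]*[1+1]) four≈0)
    where
    2≉0 : ¬ 1# + 1# ≈ 0#
    2≉0 2≈0 = -1≉1 (1+1≈0⇒-1≈1 2≈0)

module GeneratorOrder {c ℓ : Level} (F : FiniteField c ℓ)
                      {g : FiniteField.Carrier F} (gen : FiniteField.IsGenerator F g) where
  open FiniteField F hiding (zero)
  open FiniteFieldProperties F using (_≈?_; to-injective; from-injective; *-cancelˡ; ^-nonzero)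
  open CommutativeRingProperties commRing using (^-periodic)
  open import Algebra.Properties.Semiring.Exp semiring using (^-homo-*; ^-congʳ)
  open import Data.Nat.Base as ℕ using (s<s; _≤_; NonZero; >-nonZero)
  import Data.Nat.Properties as ℕ
  open import Data.Nat.DivMod using (_mod_; _divMod_; module DivMod) renaming (_/_ to _div_)
  open import Data.Fin.Base using (Fin; zero; suc; toℕ)
  import Data.Fin.Properties as Fin
  open import Data.Product using (∃; _,_; proj₁; proj₂)
  open import Data.Empty using (⊥-elim)
  open import Relation.Nullary using (¬_; yes; no)
  import Relation.Binary.PropositionalEquality as ≡
  open import Function.Bundles using (Inverse)
  open import Relation.Binary.Reasoning.Setoid setoid
  open Inverse finite using (to; from)

  g≉0 : ¬ g ≈ 0#
  g≉0 = proj₁ gen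

  -- If gᵏ = 1 then every element is 0 or one of g⁰, …, gᵏ⁻¹, so size ≤ 1 + k.
  module _ (k : ℕ) .{{_ : NonZero k}} (gᵏ≈1 : g ^ k ≈ 1#) where
    private
      element : Fin (ℕ.suc k) → Carrier
      element zero    = 0#
      element (suc r) = g ^ toℕ r

      index : Carrier → Fin (ℕ.suc k)
      index x with x ≈? 0#
      ... | yes _   = zero
      ... | no x≉0 = suc (proj₁ (proj₂ gen x x≉0) mod k)

      element-index : ∀ x → element (index x) ≈ x
      element-index x with x ≈? 0#
      ... | yes x≈0 = sym x≈0
      ... | no x≉0 = begin
        g ^ toℕ (m mod k)                           ≈⟨ ^-periodic {g} {k} gᵏ≈1 (toℕ (m mod k)) (m div k) ⟨
        g ^ (toℕ (m mod k) ℕ.+ m div k ℕ.* k)       ≡⟨ ≡.cong (g ^_) (≡.sym (DivMod.property (m divMod k))) ⟩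
        g ^ m                                       ≈⟨ proj₂ (proj₂ gen x x≉0) ⟩
        x                                           ∎
        where
        m : ℕ
        m = proj₁ (proj₂ gen x x≉0)

    gᵏ≈1⇒size≤1+k : size ≤ ℕ.suc k
    gᵏ≈1⇒size≤1+k = Fin.injective⇒≤ {f = λ a → index (from a)} λ {a} {b} eq →
      from-injective (trans (sym (element-index (from a)))
                            (trans (reflexive (≡.cong element eq)) (element-index (from b))))

  private
    zero-or-power : Fin (ℕ.suc size) → Fin size
    zero-or-power zero    = to 0#
    zero-or-power (suc a) = to (g ^ toℕ a)

  ∃period<size : ∃ λ j → 0 < j × j < size × g ^ j ≈ 1#
  ∃period<size with Fin.pigeonhole (ℕ.n<1+n size) zero-or-power
  ... | zero  , suc b , _ , eq = ⊥-elim (^-nonzero g≉0 (toℕ b) (sym (to-injective eq)))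
  ... | suc a , suc b , s<s a<b , eq =
    toℕ b ℕ.∸ toℕ a , ℕ.m<n⇒0<n∸m a<b ,
    ℕ.≤-<-trans (ℕ.m∸n≤m (toℕ b) (toℕ a)) (Fin.toℕ<n b) ,
    *-cancelˡ (^-nonzero g≉0 (toℕ a)) (begin
      g ^ toℕ a * g ^ (toℕ b ℕ.∸ toℕ a)   ≈⟨ ^-homo-* g (toℕ a) _ ⟨
      g ^ (toℕ a ℕ.+ (toℕ b ℕ.∸ toℕ a))   ≡⟨ ≡.cong (g ^_) (ℕ.m+[n∸m]≡n (ℕ.<⇒≤ a<b)) ⟩
      g ^ toℕ b                           ≈⟨ to-injective eq ⟨
      g ^ toℕ a                           ≈⟨ *-identityʳ _ ⟨
      g ^ toℕ a * 1#                      ∎)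

  size≡1+n⇒gⁿ≈1 : ∀ {n} → size ≡ ℕ.suc n → g ^ n ≈ 1#
  size≡1+n⇒gⁿ≈1 {n} size≡1+n with ∃period<size
  ... | j , 0<j , j<size , gʲ≈1 = trans (^-congʳ g (≡.sym j≡n)) gʲ≈1
    where
    j≡n : j ≡ n
    j≡n = ℕ.≤-antisym (ℕ.≤-pred (≡.subst (j <_) size≡1+n j<size))
                      (ℕ.≤-pred (≡.subst (_≤ ℕ.suc j) size≡1+n
                                         (gᵏ≈1⇒size≤1+k j {{>-nonZero 0<j}} gʲ≈1)))

  size≡1+n⇒gᵏ≉1 : ∀ {n} → size ≡ ℕ.suc n → ∀ {k} → 0 < k → k < n → ¬ g ^ k ≈ 1#
  size≡1+n⇒gᵏ≉1 size≡1+n {k} 0<k k<n gᵏ≈1 = ℕ.<⇒≱ k<n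
    (ℕ.≤-pred (≡.subst (_≤ ℕ.suc k) size≡1+n (gᵏ≈1⇒size≤1+k k {{>-nonZero 0<k}} gᵏ≈1)))

module Involution {c ℓ : Level} (F : FiniteField c ℓ)
                  {g : FiniteField.Carrier F} (gen : FiniteField.IsGenerator F g)
                  (size≡1+d*4 : FiniteField.size F ≡ ℕ.suc (FiniteField.d F ℕ.* 4))
                  {i : ℕ} (i<d : i < FiniteField.d F) where
  open FiniteField F hiding (zero)
  open GeneratorOrder F gen using (size≡1+n⇒gⁿ≈1; size≡1+n⇒gᵏ≉1)
  open FiniteFieldProperties F using (_≈?_; *-cancelˡ; *-nonzero; ^-nonzero; ⁻¹-unique; x*x≈1⇒x≈-1; four≉0)
  open CommutativeRingProperties commRing using (inverse-unique; cubic; cubic-congʳ; ^-periodic; ^-+1; ^-*-+1)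
  open Multiplier commRing
  open IntegerCoefficientSolver commRing using (solve; _:=_; _:+_; _:*_; con)
  open import Algebra.Properties.Semiring.Exp semiring using (^-homo-*; ^-assocʳ; ^-congˡ; ^-congʳ)
  open import Algebra.Properties.Ring ring using (-1*x≈-x)
  open import Data.Integer.Base using (+_)
  import Data.Nat.Properties as ℕ
  open import Data.Nat.Tactic.RingSolver using (solve-∀)
  open import Data.Nat.DivMod using (_divMod_; module DivMod)
  open import Data.Fin.Base using (Fin; toℕ; opposite)
  open import Data.Fin.Patterns using (0F; 1F; 2F; 3F)
  open import Data.Product using (∃; ∃₂; _,_; proj₁; proj₂)
  open import Data.Empty using (⊥-elim)
  open import Relation.Nullary using (yes; no)
  import Relation.Binary.PropositionalEquality as ≡
  open import Relation.Binary.Reasoning.Setoid setoid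

  j : ℕ
  j = d ℕ.∸ ℕ.suc i

  d≡1+i+j : d ≡ ℕ.suc (i ℕ.+ j)
  d≡1+i+j = ≡.sym (ℕ.m+[n∸m]≡n i<d)

  gᵈ*⁴≈1 : g ^ (d ℕ.* 4) ≈ 1#
  gᵈ*⁴≈1 = size≡1+n⇒gⁿ≈1 size≡1+d*4

  gᵏ≉1 : ∀ {k} → 0 < k → k < d ℕ.* 4 → ¬ g ^ k ≈ 1#
  gᵏ≉1 = size≡1+n⇒gᵏ≉1 size≡1+d*4

  ω u s w : Carrier
  ω = g ^ d
  u = g ^ 2
  s = g ^ (4 ℕ.* i ℕ.+ 1)
  w = (four * g ^ (4 ℕ.* i ℕ.+ 3)) ⁻¹

  g≉0 : ¬ g ≈ 0#
  g≉0 = proj₁ gen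

  0<d : 0 < d
  0<d = ≡.subst (0 <_) (≡.sym d≡1+i+j) ℕ.z<s

  private
    d*4≡[d+d]+[d+d] : ∀ d → d ℕ.* 4 ≡ (d ℕ.+ d) ℕ.+ (d ℕ.+ d)
    d*4≡[d+d]+[d+d] = solve-∀

    ω*ω≈gᵈ⁺ᵈ : ω * ω ≈ g ^ (d ℕ.+ d)
    ω*ω≈gᵈ⁺ᵈ = sym (^-homo-* g d d)

  ω*ω≉1 : ¬ ω * ω ≈ 1#
  ω*ω≉1 ω*ω≈1 = gᵏ≉1 0<d+d
    (≡.subst (d ℕ.+ d <_) (≡.sym (d*4≡[d+d]+[d+d] d)) (ℕ.m<m+n (d ℕ.+ d) 0<d+d))
    (trans (sym ω*ω≈gᵈ⁺ᵈ) ω*ω≈1)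
    where
    0<d+d : 0 < d ℕ.+ d
    0<d+d = ℕ.<-≤-trans 0<d (ℕ.m≤m+n d d)

  ω*ω≈-1 : ω * ω ≈ - 1#
  ω*ω≈-1 = x*x≈1⇒x≈-1 (begin
    (ω * ω) * (ω * ω)                  ≈⟨ *-cong ω*ω≈gᵈ⁺ᵈ ω*ω≈gᵈ⁺ᵈ ⟩
    g ^ (d ℕ.+ d) * g ^ (d ℕ.+ d)      ≈⟨ ^-homo-* g (d ℕ.+ d) (d ℕ.+ d) ⟨
    g ^ ((d ℕ.+ d) ℕ.+ (d ℕ.+ d))      ≡⟨ ≡.cong (g ^_) (≡.sym (d*4≡[d+d]+[d+d] d)) ⟩
    g ^ (d ℕ.* 4)                      ≈⟨ gᵈ*⁴≈1 ⟩
    1#                                 ∎) ω*ω≉1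

  -1≉1 : ¬ - 1# ≈ 1#
  -1≉1 -1≈1 = ω*ω≉1 (trans ω*ω≈-1 -1≈1)

  g^[4i+3]≈u*s : g ^ (4 ℕ.* i ℕ.+ 3) ≈ u * s
  g^[4i+3]≈u*s = trans (^-congʳ g (4i+3≡2+[4i+1] i)) (^-homo-* g 2 (4 ℕ.* i ℕ.+ 1))
    where
    4i+3≡2+[4i+1] : ∀ i → 4 ℕ.* i ℕ.+ 3 ≡ 2 ℕ.+ (4 ℕ.* i ℕ.+ 1)
    4i+3≡2+[4i+1] = solve-∀

  g^[2[4i+2]]≈u*[s*s] : g ^ (2 ℕ.* (4 ℕ.* i ℕ.+ 2)) ≈ u * (s * s)
  g^[2[4i+2]]≈u*[s*s] = begin
    g ^ (2 ℕ.* (4 ℕ.* i ℕ.+ 2))   ≡⟨ ≡.cong (g ^_) (2[4i+2]≡2+[[4i+1]+[4i+1]] i) ⟩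
    g ^ (2 ℕ.+ (n ℕ.+ n))         ≈⟨ ^-homo-* g 2 (n ℕ.+ n) ⟩
    u * g ^ (n ℕ.+ n)             ≈⟨ *-congˡ (^-homo-* g n n) ⟩
    u * (s * s)                   ∎
    where
    n : ℕ
    n = 4 ℕ.* i ℕ.+ 1
    2[4i+2]≡2+[[4i+1]+[4i+1]] : ∀ i → 2 ℕ.* (4 ℕ.* i ℕ.+ 2) ≡ 2 ℕ.+ ((4 ℕ.* i ℕ.+ 1) ℕ.+ (4 ℕ.* i ℕ.+ 1))
    2[4i+2]≡2+[[4i+1]+[4i+1]] = solve-∀

  g^[4i+d+3]≈u*s*ω : g ^ (4 ℕ.* i ℕ.+ d ℕ.+ 3) ≈ u * s * ω
  g^[4i+d+3]≈u*s*ω = begin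
    g ^ (4 ℕ.* i ℕ.+ d ℕ.+ 3)          ≡⟨ ≡.cong (g ^_) (4i+d+3≡[4i+3]+d i d) ⟩
    g ^ ((4 ℕ.* i ℕ.+ 3) ℕ.+ d)        ≈⟨ ^-homo-* g (4 ℕ.* i ℕ.+ 3) d ⟩
    g ^ (4 ℕ.* i ℕ.+ 3) * ω            ≈⟨ *-congʳ g^[4i+3]≈u*s ⟩
    u * s * ω                          ∎
    where
    4i+d+3≡[4i+3]+d : ∀ i d → 4 ℕ.* i ℕ.+ d ℕ.+ 3 ≡ (4 ℕ.* i ℕ.+ 3) ℕ.+ d
    4i+d+3≡[4i+3]+d = solve-∀

  D≈1 : four * (u * s) * w ≈ 1#
  D≈1 = trans (*-congʳ (*-congˡ (sym g^[4i+3]≈u*s)))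
              (inverseʳ _ (*-nonzero (four≉0 -1≉1) (^-nonzero g≉0 (4 ℕ.* i ℕ.+ 3))))

  a₀≈c₀ : a₀ g i ≈ c₀ u s ω w
  a₀≈c₀ = *-congʳ (*-congˡ (+-congʳ g^[2[4i+2]]≈u*[s*s]))

  a₂≈c₂ : a₂ g i ≈ c₂ u s ω w
  a₂≈c₂ = *-congʳ (*-congˡ (+-congʳ g^[2[4i+2]]≈u*[s*s]))

  shifted-denominator⁻¹ : (four * g ^ (4 ℕ.* i ℕ.+ d ℕ.+ 3)) ⁻¹ ≈ - (ω * w)
  shifted-denominator⁻¹ = sym (⁻¹-unique (trans (*-congʳ (*-congˡ g^[4i+d+3]≈u*s*ω))
                                                (ω-shifted-inverse≈1 ω*ω≈-1 D≈1)))

  a₁≈c₁ : a₁ g i ≈ c₁ u s ω w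
  a₁≈c₁ = *-cong (*-cong (+-congʳ (^-homo-* g d 2)) (+-congʳ g^[2[4i+2]]≈u*[s*s]))
                 shifted-denominator⁻¹

  a₃≈c₃ : a₃ g i ≈ c₃ u s ω w
  a₃≈c₃ = *-cong (*-cong (+-congʳ (^-homo-* g d 2)) (+-congʳ g^[2[4i+2]]≈u*[s*s]))
                 shifted-denominator⁻¹

  f≈x*multiplier : ∀ x → f g i x ≈ x * multiplier u s ω w (x ^ d)
  f≈x*multiplier x = begin
    f g i x
      ≈⟨ +-cong (+-cong (+-cong (*-cong a₃≈c₃ (^-*-+1 x 3 d)) (*-cong a₂≈c₂ (^-*-+1 x 2 d)))
                        (*-cong a₁≈c₁ (^-+1 x d))) (*-congʳ a₀≈c₀) ⟩
    c₃ u s ω w * ((x ^ d) ^ 3 * x) + c₂ u s ω w * ((x ^ d) ^ 2 * x) + c₁ u s ω w * (x ^ d * x) + c₀ u s ω w * x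
      ≈⟨ factor _ _ _ _ (x ^ d) x ⟩
    x * multiplier u s ω w (x ^ d) ∎
    where
    factor : ∀ a₀ a₁ a₂ a₃ y x →
             a₃ * (y * (y * (y * 1#)) * x) + a₂ * (y * (y * 1#) * x) + a₁ * (y * x) + a₀ * x
             ≈ x * cubic a₀ a₁ a₂ a₃ y
    factor = solve 6 (λ a₀ a₁ a₂ a₃ y x →
      a₃ :* (y :* (y :* (y :* con (+ 1))) :* x) :+ a₂ :* (y :* (y :* con (+ 1)) :* x)
        :+ a₁ :* (y :* x) :+ a₀ :* x
        := x :* (a₃ :* (y :* y :* y) :+ a₂ :* (y :* y) :+ a₁ :* y :+ a₀)) refl

  e : Fin 4 → ℕ
  e 0F = 4 ℕ.* i ℕ.+ 3
  e 1F = 4 ℕ.* i ℕ.+ 1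
  e 2F = 4 ℕ.* j ℕ.+ 3
  e 3F = 4 ℕ.* j ℕ.+ 1

  e+e∘opposite≡d*4 : ∀ r → e r ℕ.+ e (opposite r) ≡ d ℕ.* 4
  e+e∘opposite≡d*4 r = ≡.trans (sum r) (≡.cong (ℕ._* 4) (≡.sym d≡1+i+j))
    where
    [4i+3]+[4j+1] : ∀ i j → (4 ℕ.* i ℕ.+ 3) ℕ.+ (4 ℕ.* j ℕ.+ 1) ≡ ℕ.suc (i ℕ.+ j) ℕ.* 4
    [4i+3]+[4j+1] = solve-∀
    [4i+1]+[4j+3] : ∀ i j → (4 ℕ.* i ℕ.+ 1) ℕ.+ (4 ℕ.* j ℕ.+ 3) ≡ ℕ.suc (i ℕ.+ j) ℕ.* 4
    [4i+1]+[4j+3] = solve-∀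
    [4j+3]+[4i+1] : ∀ i j → (4 ℕ.* j ℕ.+ 3) ℕ.+ (4 ℕ.* i ℕ.+ 1) ≡ ℕ.suc (i ℕ.+ j) ℕ.* 4
    [4j+3]+[4i+1] = solve-∀
    [4j+1]+[4i+3] : ∀ i j → (4 ℕ.* j ℕ.+ 1) ℕ.+ (4 ℕ.* i ℕ.+ 3) ≡ ℕ.suc (i ℕ.+ j) ℕ.* 4
    [4j+1]+[4i+3] = solve-∀
    sum : ∀ r → e r ℕ.+ e (opposite r) ≡ ℕ.suc (i ℕ.+ j) ℕ.* 4
    sum 0F = [4i+3]+[4j+1] i j
    sum 1F = [4i+1]+[4j+3] i j
    sum 2F = [4j+3]+[4i+1] i j
    sum 3F = [4j+1]+[4i+3] i j

  residue-shift : ∀ r q → ∃ λ q′ → toℕ r ℕ.+ q ℕ.* 4 ℕ.+ e r ≡ toℕ (opposite r) ℕ.+ q′ ℕ.* 4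
  residue-shift 0F q = q ℕ.+ i , shift₀ q i
    where
    shift₀ : ∀ q i → 0 ℕ.+ q ℕ.* 4 ℕ.+ (4 ℕ.* i ℕ.+ 3) ≡ 3 ℕ.+ (q ℕ.+ i) ℕ.* 4
    shift₀ = solve-∀
  residue-shift 1F q = q ℕ.+ i , shift₁ q i
    where
    shift₁ : ∀ q i → 1 ℕ.+ q ℕ.* 4 ℕ.+ (4 ℕ.* i ℕ.+ 1) ≡ 2 ℕ.+ (q ℕ.+ i) ℕ.* 4
    shift₁ = solve-∀
  residue-shift 2F q = q ℕ.+ ℕ.suc j , shift₂ q j
    where
    shift₂ : ∀ q j → 2 ℕ.+ q ℕ.* 4 ℕ.+ (4 ℕ.* j ℕ.+ 3) ≡ 1 ℕ.+ (q ℕ.+ ℕ.suc j) ℕ.* 4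
    shift₂ = solve-∀
  residue-shift 3F q = q ℕ.+ ℕ.suc j , shift₃ q j
    where
    shift₃ : ∀ q j → 3 ℕ.+ q ℕ.* 4 ℕ.+ (4 ℕ.* j ℕ.+ 1) ≡ 0 ℕ.+ (q ℕ.+ ℕ.suc j) ℕ.* 4
    shift₃ = solve-∀

  0<e : ∀ r → 0 < e r
  0<e 0F = ℕ.<-≤-trans ℕ.z<s (ℕ.m≤n+m 3 (4 ℕ.* i))
  0<e 1F = ℕ.<-≤-trans ℕ.z<s (ℕ.m≤n+m 1 (4 ℕ.* i))
  0<e 2F = ℕ.<-≤-trans ℕ.z<s (ℕ.m≤n+m 3 (4 ℕ.* j))
  0<e 3F = ℕ.<-≤-trans ℕ.z<s (ℕ.m≤n+m 1 (4 ℕ.* j))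

  e<d*4 : ∀ r → e r < d ℕ.* 4
  e<d*4 r = ≡.subst (e r <_) (e+e∘opposite≡d*4 r) (ℕ.m<m+n (e r) (0<e (opposite r)))

  gᵉ*gᵉ∘opposite≈1 : ∀ r → g ^ e r * g ^ e (opposite r) ≈ 1#
  gᵉ*gᵉ∘opposite≈1 r =
    trans (sym (^-homo-* g (e r) (e (opposite r)))) (trans (^-congʳ g (e+e∘opposite≡d*4 r)) gᵈ*⁴≈1)

  multiplier-at-ω^ : ∀ r → multiplier u s ω w (ω ^ toℕ r) ≈ g ^ e r
  multiplier-at-ω^ 0F = trans (multiplier-at-1 ω*ω≈-1 D≈1) (sym g^[4i+3]≈u*s)
  multiplier-at-ω^ 1F = trans (cubic-congʳ (*-identityʳ ω)) (multiplier-at-ω ω*ω≈-1 D≈1)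
  multiplier-at-ω^ 2F = inverse-unique
    (trans (*-congˡ (cubic-congʳ ω²≈-1)) (multiplier-at--1 ω*ω≈-1 D≈1)) (gᵉ*gᵉ∘opposite≈1 1F)
    where
    ω²≈-1 : ω * (ω * 1#) ≈ - 1#
    ω²≈-1 = trans (*-congˡ (*-identityʳ ω)) ω*ω≈-1
  multiplier-at-ω^ 3F = inverse-unique
    (trans (*-congˡ (cubic-congʳ ω³≈-ω)) (multiplier-at--ω ω*ω≈-1 D≈1))
    (trans (*-congʳ (sym g^[4i+3]≈u*s)) (gᵉ*gᵉ∘opposite≈1 0F))
    where
    ω³≈-ω : ω * (ω * (ω * 1#)) ≈ - ω
    ω³≈-ω = begin
      ω * (ω * (ω * 1#))   ≈⟨ *-assoc ω ω (ω * 1#) ⟨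
      (ω * ω) * (ω * 1#)   ≈⟨ *-cong ω*ω≈-1 (*-identityʳ ω) ⟩
      - 1# * ω             ≈⟨ -1*x≈-x ω ⟩
      - ω                  ∎

  power^d : ∀ (r : Fin 4) q → (g ^ (toℕ r ℕ.+ q ℕ.* 4)) ^ d ≈ ω ^ toℕ r
  power^d r q = begin
    (g ^ k) ^ d    ≈⟨ ^-assocʳ g k d ⟩
    g ^ (k ℕ.* d)  ≡⟨ ≡.cong (g ^_) (ℕ.*-comm k d) ⟩
    g ^ (d ℕ.* k)  ≈⟨ ^-assocʳ g d k ⟨
    ω ^ k          ≈⟨ ^-periodic {ω} {4} ω⁴≈1 (toℕ r) q ⟩
    ω ^ toℕ r      ∎
    where
    k : ℕ
    k = toℕ r ℕ.+ q ℕ.* 4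
    ω⁴≈1 : ω ^ 4 ≈ 1#
    ω⁴≈1 = trans (^-assocʳ g d 4) gᵈ*⁴≈1

  f-on-power : ∀ r q → f g i (g ^ (toℕ r ℕ.+ q ℕ.* 4)) ≈ g ^ (toℕ r ℕ.+ q ℕ.* 4 ℕ.+ e r)
  f-on-power r q = begin
    f g i (g ^ k)                                   ≈⟨ f≈x*multiplier (g ^ k) ⟩
    g ^ k * multiplier u s ω w ((g ^ k) ^ d)        ≈⟨ *-congˡ (cubic-congʳ (power^d r q)) ⟩
    g ^ k * multiplier u s ω w (ω ^ toℕ r)          ≈⟨ *-congˡ (multiplier-at-ω^ r) ⟩
    g ^ k * g ^ e r                                 ≈⟨ ^-homo-* g k (e r) ⟨
    g ^ (k ℕ.+ e r)                                 ∎
    where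
    k : ℕ
    k = toℕ r ℕ.+ q ℕ.* 4

  f-cong : ∀ {x y} → x ≈ y → f g i x ≈ f g i y
  f-cong {x} {y} x≈y = trans (f≈x*multiplier x)
    (trans (*-cong x≈y (cubic-congʳ (^-congˡ d x≈y))) (sym (f≈x*multiplier y)))

  f∘f-on-power : ∀ r q → f g i (f g i (g ^ (toℕ r ℕ.+ q ℕ.* 4))) ≈ g ^ (toℕ r ℕ.+ q ℕ.* 4)
  f∘f-on-power r q with residue-shift r q
  ... | q′ , k+e≡k′ = begin
    f g i (f g i (g ^ k))                   ≈⟨ f-cong (f-on-power r q) ⟩
    f g i (g ^ (k ℕ.+ e r))                 ≡⟨ ≡.cong (λ m → f g i (g ^ m)) k+e≡k′ ⟩
    f g i (g ^ k′)                          ≈⟨ f-on-power (opposite r) q′ ⟩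
    g ^ (k′ ℕ.+ e (opposite r))             ≡⟨ ≡.cong (g ^_) exponent≡ ⟩
    g ^ (k ℕ.+ d ℕ.* 4)                     ≈⟨ ^-homo-* g k (d ℕ.* 4) ⟩
    g ^ k * g ^ (d ℕ.* 4)                   ≈⟨ *-congˡ gᵈ*⁴≈1 ⟩
    g ^ k * 1#                              ≈⟨ *-identityʳ _ ⟩
    g ^ k                                   ∎
    where
    k k′ : ℕ
    k = toℕ r ℕ.+ q ℕ.* 4
    k′ = toℕ (opposite r) ℕ.+ q′ ℕ.* 4
    exponent≡ : k′ ℕ.+ e (opposite r) ≡ k ℕ.+ d ℕ.* 4
    exponent≡ = ≡.trans (≡.cong (ℕ._+ e (opposite r)) (≡.sym k+e≡k′))
                (≡.trans (ℕ.+-assoc k (e r) (e (opposite r))) (≡.cong (k ℕ.+_) (e+e∘opposite≡d*4 r)))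

  f-on-power≉ : ∀ r q → ¬ f g i (g ^ (toℕ r ℕ.+ q ℕ.* 4)) ≈ g ^ (toℕ r ℕ.+ q ℕ.* 4)
  f-on-power≉ r q fixed = gᵏ≉1 (0<e r) (e<d*4 r) (*-cancelˡ (^-nonzero g≉0 k) (begin
    g ^ k * g ^ e r      ≈⟨ ^-homo-* g k (e r) ⟨
    g ^ (k ℕ.+ e r)      ≈⟨ f-on-power r q ⟨
    f g i (g ^ k)        ≈⟨ fixed ⟩
    g ^ k                ≈⟨ *-identityʳ _ ⟨
    g ^ k * 1#           ∎))
    where
    k : ℕ
    k = toℕ r ℕ.+ q ℕ.* 4

  nonzero⇒power : ∀ {x} → ¬ x ≈ 0# → ∃₂ λ r q → x ≈ g ^ (toℕ r ℕ.+ q ℕ.* 4)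
  nonzero⇒power {x} x≉0 with proj₂ gen x x≉0
  ... | m , gᵐ≈x = DivMod.remainder (m divMod 4) , DivMod.quotient (m divMod 4) ,
    trans (sym gᵐ≈x) (^-congʳ g (DivMod.property (m divMod 4)))

  f-zero : f g i 0# ≈ 0#
  f-zero = trans (f≈x*multiplier 0#) (zeroˡ _)

  f-involutive : ∀ x → f g i (f g i x) ≈ x
  f-involutive x with x ≈? 0#
  ... | yes x≈0 = trans (f-cong (trans (f-cong x≈0) f-zero)) (trans f-zero (sym x≈0))
  ... | no x≉0 with nonzero⇒power x≉0
  ...   | r , q , x≈gᵏ = trans (f-cong (f-cong x≈gᵏ)) (trans (f∘f-on-power r q) (sym x≈gᵏ))

  fixed⇒zero : ∀ x → f g i x ≈ x → x ≈ 0#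
  fixed⇒zero x fx≈x with x ≈? 0#
  ... | yes x≈0 = x≈0
  ... | no x≉0 with nonzero⇒power x≉0
  ...   | r , q , x≈gᵏ = ⊥-elim (f-on-power≉ r q (trans (f-cong (sym x≈gᵏ)) (trans fx≈x x≈gᵏ)))

theorem2 : ∀ {c ℓ : Level} (F : FiniteField c ℓ) →
           FiniteField.size F % 4 ≡ 1 →
           (g : FiniteField.Carrier F) → FiniteField.IsGenerator F g →
           (i : ℕ) → i < FiniteField.d F →
           (∀ x → FiniteField._≈_ F (FiniteField.f F g i (FiniteField.f F g i x)) x)
           × FiniteField._≈_ F (FiniteField.f F g i (FiniteField.0# F)) (FiniteField.0# F)
           × (∀ x → FiniteField._≈_ F (FiniteField.f F g i x) x → FiniteField._≈_ F x (FiniteField.0# F))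
theorem2 F size%4≡1 g gen i i<d = f-involutive , f-zero , fixed⇒zero
  where
  open FiniteFieldProperties F using (size≡1+d*4)
  open Involution F gen (size≡1+d*4 size%4≡1) i<d using (f-involutive; f-zero; fixed⇒zero)
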